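{- Let $\Gamma=(V,E)$ be a finite simple connected graph with diameter $D=D(\Gamma)$, and let $\Box\Gamma$ be its diametral doubling. Then for each $\epsilon\in\{+,-\}$ the subgraph of $\Box\Gamma$ induced on $V^\epsilon$ is isometric, i.e. $d_{\Box\Gamma}(x^\epsilon,y^\epsilon)=d_\Gamma(x,y)$ for all $x,y\in V$, if and only if $$d_\Gamma(x,y)\le 2+d_\Gamma(z_1,z_2)\quad\text{for all } x,y,z_1,z_2\in V \text{ with } d_\Gamma(x,z_1)=d_\Gamma(y,z_2)=D.$$
   Context: $d_\Gamma$ is the shortest-path distance and $D(\Gamma)$ the maximum of $d_\Gamma$ over all pairs of vertices. The diametral doubling $\Box\Gamma$ has vertex set $V^+\cup V^-$, where $V^+=\{x^+:x\in V\}$ and $V^-=\{x^-:x\in V\}$ are two disjoint copies of $V$; $x^\mu$ is adjacent to $y^\epsilon$ if either $\mu=\epsilon$ and $\{x,y\}\in E$, or $\mu\ne\epsilon$ and $d_\Gamma(x,y)=D(\Gamma)$. -}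

module Defs where

open import Data.Nat using (ℕ; zero; suc; _≤_; _+_)
open import Data.Fin using (Fin)
open import Data.Product using (Σ; ∃; _×_; _,_)
open import Data.Sum using (_⊎_)
open import Relation.Nullary using (¬_; Dec)
open import Relation.Binary.PropositionalEquality using (_≡_; _≢_)

record Graph : Set₁ where
  field
    n     : ℕ
    Adj   : Fin n → Fin n → Set
    sym   : ∀ {x y} → Adj x y → Adj y x
    irr   : ∀ {x} → ¬ Adj x x
    dec   : ∀ x y → Dec (Adj x y)

open Graph public

data Walk {A : Set} (R : A → A → Set) : A → A → ℕ → Set where
  nil  : ∀ {x} → Walk R x x zero
  cons : ∀ {x y z k} → R x y → Walk R y z k → Walk R x z (suc k)

IsDist : {A : Set} (R : A → A → Set) → A → A → ℕ → Set
IsDist R x y k = Walk R x y k × (∀ m → Walk R x y m → k ≤ m)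

Connected : Graph → Set
Connected G = ∀ x y → ∃ λ k → Walk (Adj G) x y k

IsDiameter : Graph → ℕ → Set
IsDiameter G D =
  (∃ λ x → ∃ λ y → IsDist (Adj G) x y D) ×
  (∀ x y k → IsDist (Adj G) x y k → k ≤ D)

data Sign : Set where
  plus minus : Sign

DoubAdj : (G : Graph) → ℕ → Fin (n G) × Sign → Fin (n G) × Sign → Set
DoubAdj G D (x , μ) (y , ε) =
  (μ ≡ ε × Adj G x y) ⊎ (μ ≢ ε × IsDist (Adj G) x y D)

{-# OPTIONS --safe #-}
-- Walks in □Γ are analysed by induction: one of length m between equal signs
-- yields a Γ-walk of length ≤ m, one between opposite signs yields Γ-walks
-- x ⇝ u and w ⇝ y joined by a diametral pair u, w, of total length < m. Prepending
-- a sign change x^μ → x′^ν to the latter, the condition (for the diametral pairs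
-- x, x′ and w, u) gives d(x,w) ≤ 2 + d(x′,u), so both sign changes are traded for
-- a shortest Γ-path x ⇝ w without lengthening the walk. Conversely, the walk
-- x⁺ → z₁⁻ ⇝ z₂⁻ → y⁺ shows that isometric copies force the condition.
module Submission where

open import Defs
open import Data.Nat using (ℕ; _≤_; _+_)
open import Data.Product using (_×_; _,_)
open import Function.Bundles using (_⇔_)

open import Data.Nat using (zero; suc; _<_; s≤s; z≤n)
open import Data.Nat.Induction using (<-rec)
open import Data.Nat.Properties using (anyUpTo?; ≮⇒≥; ≤-trans; +-monoˡ-≤; module ≤-Reasoning)
open import Data.Fin using (Fin; _≟_)
open import Data.Fin.Properties using (any?)
open import Data.Product using (∃; ∃₂; proj₁; proj₂)
open import Data.Sum using (inj₁; inj₂)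
open import Data.Empty using (⊥-elim)
open import Relation.Nullary using (Dec; yes; no)
open import Relation.Nullary.Decidable using (_×-dec_)
open import Relation.Binary.Definitions using (Symmetric; Decidable)
open import Relation.Binary.PropositionalEquality using (_≡_; _≢_; refl; ≢-sym)
open import Function.Bundles using (mk⇔)

Least : (ℕ → Set) → Set
Least P = ∃ λ j → P j × (∀ m → P m → j ≤ m)

least-witness : {P : ℕ → Set} → (∀ k → Dec (P k)) → ∀ {k} → P k → Least P
least-witness {P} P? {k} = <-rec (λ k → P k → Least P) step k
  where
  step : ∀ k → (∀ {i} → i < k → P i → Least P) → P k → Least P
  step k smaller Pk with anyUpTo? P? k
  ... | yes (i , i<k , Pi) = smaller i<k Pi
  ... | no none            = k , Pk , λ m Pm → ≮⇒≥ (λ m<k → none (m , m<k , Pm))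

Walk≤ : {A : Set} → (A → A → Set) → A → A → ℕ → Set
Walk≤ R x y m = ∃ λ j → j ≤ m × Walk R x y j

module _ {A : Set} {R : A → A → Set} where

  infixr 5 _++ʷ_
  infixl 5 _∷ʳʷ_

  _++ʷ_ : ∀ {x y z a b} → Walk R x y a → Walk R y z b → Walk R x z (a + b)
  nil      ++ʷ w′ = w′
  cons e w ++ʷ w′ = cons e (w ++ʷ w′)

  _∷ʳʷ_ : ∀ {x y z k} → Walk R x y k → R y z → Walk R x z (suc k)
  nil      ∷ʳʷ e′ = cons e′ nil
  cons e w ∷ʳʷ e′ = cons e (w ∷ʳʷ e′)

  mapʷ : {B : Set} {S : B → B → Set} (f : A → B) → (∀ {x y} → R x y → S (f x) (f y)) →
         ∀ {x y k} → Walk R x y k → Walk S (f x) (f y) k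
  mapʷ f g nil        = nil
  mapʷ f g (cons e w) = cons (g e) (mapʷ f g w)

  reverseʷ : Symmetric R → ∀ {x y k} → Walk R x y k → Walk R y x k
  reverseʷ sym nil        = nil
  reverseʷ sym (cons e w) = reverseʷ sym w ∷ʳʷ sym e

  IsDist-sym : Symmetric R → ∀ {x y k} → IsDist R x y k → IsDist R y x k
  IsDist-sym sym (w , shortest) = reverseʷ sym w , λ m w′ → shortest m (reverseʷ sym w′)

module _ {n : ℕ} {R : Fin n → Fin n → Set} (R? : Decidable R) where

  walk? : ∀ k x y → Dec (Walk R x y k)
  walk? zero x y with x ≟ y
  ... | yes refl = yes nil
  ... | no x≢y   = no λ { nil → x≢y refl }
  walk? (suc k) x y with any? (λ z → R? x z ×-dec walk? k z y)
  ... | yes (z , e , w) = yes (cons e w)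
  ... | no none         = no λ { (cons e w) → none (_ , e , w) }

  walk⇒dist : ∀ {x y k} → Walk R x y k → ∃ (IsDist R x y)
  walk⇒dist w = least-witness (λ k → walk? k _ _) w

≢-≢⇒≡ : ∀ {μ ν ρ : Sign} → μ ≢ ν → μ ≢ ρ → ν ≡ ρ
≢-≢⇒≡ {_}     {plus}  {plus}  _   _   = refl
≢-≢⇒≡ {_}     {minus} {minus} _   _   = refl
≢-≢⇒≡ {plus}  {plus}  {minus} μ≢ν _   = ⊥-elim (μ≢ν refl)
≢-≢⇒≡ {minus} {minus} {plus}  μ≢ν _   = ⊥-elim (μ≢ν refl)
≢-≢⇒≡ {plus}  {minus} {plus}  _   μ≢ρ = ⊥-elim (μ≢ρ refl)
≢-≢⇒≡ {minus} {plus}  {minus} _   μ≢ρ = ⊥-elim (μ≢ρ refl)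

module Doubling (G : Graph) (D : ℕ) where

  V : Set
  V = Fin (n G)

  IsometricCopies : Set
  IsometricCopies = ∀ ε x y k → IsDist (Adj G) x y k → IsDist (DoubAdj G D) (x , ε) (y , ε) k

  DiametralCondition : Set
  DiametralCondition = ∀ x y z₁ z₂ a b → IsDist (Adj G) x z₁ D → IsDist (Adj G) y z₂ D →
                       IsDist (Adj G) x y a → IsDist (Adj G) z₁ z₂ b → a ≤ 2 + b

  inCopy : ∀ ε {x y k} → Walk (Adj G) x y k → Walk (DoubAdj G D) (x , ε) (y , ε) k
  inCopy ε = mapʷ (_, ε) (λ e → inj₁ (refl , e))

  Crossing : V → V → ℕ → Set
  Crossing x y m = ∃₂ λ u w → ∃₂ λ p q →
    IsDist (Adj G) u w D × Walk (Adj G) x u p × Walk (Adj G) w y q × suc (p + q) ≤ m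

  record Shadow (x y : V) (μ ν : Sign) (m : ℕ) : Set where
    field
      parallel : μ ≡ ν → Walk≤ (Adj G) x y m
      crossing : μ ≢ ν → Crossing x y m

  open Shadow

  Shadow-∷-inner : ∀ {x x′ y μ ν m} → Adj G x x′ → Shadow x′ y μ ν m → Shadow x y μ ν (suc m)
  Shadow-∷-inner e s .parallel μ≡ν with s .parallel μ≡ν
  ... | j , j≤m , w = suc j , s≤s j≤m , cons e w
  Shadow-∷-inner e s .crossing μ≢ν with s .crossing μ≢ν
  ... | u , w , p , q , duw , xu , wy , le = u , w , suc p , q , duw , cons e xu , wy , s≤s le

  detour : DiametralCondition → ∀ {x x′ y m} → IsDist (Adj G) x x′ D → Crossing x′ y m →
           Walk≤ (Adj G) x y (suc m)
  detour cond {x} {x′} {_} {m} dxx′ (u , w , p , q , duw , x′u , wy , p+q<m)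
    with walk⇒dist (dec G) (proj₁ dxx′ ++ʷ x′u ++ʷ proj₁ duw) | walk⇒dist (dec G) x′u
  ... | a , dxw | b , dx′u = a + q , bound , proj₁ dxw ++ʷ wy
    where
    open ≤-Reasoning
    bound : a + q ≤ suc m
    bound = begin
      a + q      ≤⟨ +-monoˡ-≤ q (cond x w x′ u a b dxx′ (IsDist-sym (sym G) duw) dxw dx′u) ⟩
      2 + b + q  ≤⟨ +-monoˡ-≤ q (s≤s (s≤s (proj₂ dx′u p x′u))) ⟩
      2 + p + q  ≤⟨ s≤s p+q<m ⟩
      suc m      ∎

  Shadow-∷-cross : DiametralCondition → ∀ {x x′ y μ μ′ ν m} → μ ≢ μ′ → IsDist (Adj G) x x′ D →
                   Shadow x′ y μ′ ν m → Shadow x y μ ν (suc m)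
  Shadow-∷-cross cond μ≢μ′ dxx′ s .parallel refl = detour cond dxx′ (s .crossing (≢-sym μ≢μ′))
  Shadow-∷-cross cond {x} {x′} μ≢μ′ dxx′ s .crossing μ≢ν with s .parallel (≢-≢⇒≡ μ≢μ′ μ≢ν)
  ... | j , j≤m , w = x , x′ , 0 , j , dxx′ , nil , w , s≤s j≤m

  walk⇒shadow : DiametralCondition → ∀ {x y μ ν m} → Walk (DoubAdj G D) (x , μ) (y , ν) m →
                Shadow x y μ ν m
  walk⇒shadow cond nil .parallel _    = 0 , z≤n , nil
  walk⇒shadow cond nil .crossing μ≢μ  = ⊥-elim (μ≢μ refl)
  walk⇒shadow cond (cons (inj₁ (refl , e))  w) = Shadow-∷-inner e (walk⇒shadow cond w)
  walk⇒shadow cond (cons (inj₂ (μ≢μ′ , d)) w) = Shadow-∷-cross cond μ≢μ′ d (walk⇒shadow cond w)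

  isometric⇒diametralCondition : IsometricCopies → DiametralCondition
  isometric⇒diametralCondition iso x y z₁ z₂ a b dxz₁ dyz₂ dxy dz₁z₂ =
    proj₂ (iso plus x y a dxy) (2 + b) x⁺⇝y⁺
    where
    x⁺⇝y⁺ : Walk (DoubAdj G D) (x , plus) (y , plus) (2 + b)
    x⁺⇝y⁺ = cons (inj₂ ((λ ()) , dxz₁))
              (inCopy minus (proj₁ dz₁z₂) ∷ʳʷ inj₂ ((λ ()) , IsDist-sym (sym G) dyz₂))

  diametralCondition⇒isometric : DiametralCondition → IsometricCopies
  diametralCondition⇒isometric cond ε x y k dxy = inCopy ε (proj₁ dxy) , shortest
    where
    shortest : ∀ m → Walk (DoubAdj G D) (x , ε) (y , ε) m → k ≤ m
    shortest m w with walk⇒shadow cond w .parallel refl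
    ... | j , j≤m , wj = ≤-trans (proj₂ dxy j wj) j≤m

lemma7 : (G : Graph) → Connected G → (D : ℕ) → IsDiameter G D →
    ((∀ ε x y k → IsDist (Adj G) x y k → IsDist (DoubAdj G D) (x , ε) (y , ε) k)
     ⇔
     (∀ x y z₁ z₂ a b → IsDist (Adj G) x z₁ D → IsDist (Adj G) y z₂ D →
        IsDist (Adj G) x y a → IsDist (Adj G) z₁ z₂ b → a ≤ 2 + b))
lemma7 G _ D _ = mk⇔ isometric⇒diametralCondition diametralCondition⇒isometric
  where open Doubling G D
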